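{- Let $n\in\mathbb{N}$ and $1\le i\le n$. Then $$\sum_{\substack{(a_1,\ldots,a_n)\in\mathcal{A}_n\\ a_{i+1}=\cdots=a_n=0}}c_{(a_1,\ldots,a_n)}=i!\,i^{\,n-i}.$$
   Context: For $n\in\mathbb{N}$ and indeterminates $x_1,\ldots,x_n$, let $p_n=x_1(x_1+x_2)\cdots(x_1+x_2+\cdots+x_n)$. Let $\mathbb{N}_0=\mathbb{N}\cup\{0\}$ and $\mathcal{A}_n=\{(a_1,\ldots,a_n)\in\mathbb{N}_0^n : \sum_{i=k+1}^n a_i\le n-k \text{ for all } 1\le k\le n-1,\ \sum_{i=1}^n a_i=n\}$; these are exactly the exponent vectors of the monomials of $p_n$. For $a\in\mathcal{A}_n$, $c_a$ denotes the coefficient of $x_1^{a_1}\cdots x_n^{a_n}$ in the expansion of $p_n$. For $i=n$ the condition $a_{i+1}=\cdots=a_n=0$ is vacuous. -}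

module Defs where

open import Data.Nat using (ℕ; zero; suc; _+_; _∸_; _≤_; _≤?_)
open import Data.Nat.Properties using (_≟_)
open import Data.Fin using (Fin; toℕ)
open import Data.Fin.Properties using () renaming (_≟_ to _≟F_)
open import Data.List using (List; []; _∷_; map; concatMap; filter; drop; upTo; allFin; foldr; length; [_])
open import Data.List.Relation.Unary.All using (All; all?)
import Data.Vec
open import Data.Vec using (Vec; tabulate; zipWith; replicate; toList)
open import Data.Nat.ListAction using (sum)
open import Data.Vec.Properties using (≡-dec)
open import Data.Product using (_×_)
open import Relation.Nullary using (Dec; ¬_)
open import Relation.Nullary.Decidable using (_×-dec_)
open import Relation.Binary.PropositionalEquality using (_≡_)

Mono : ℕ → Set
Mono n = Vec ℕ n

-- A polynomial with ℕ-coefficients, written as a formal sum of monomials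
-- (a list; repeated monomials add up).  Coefficient of a = multiplicity of a.
Poly : ℕ → Set
Poly n = List (Mono n)

coeffOf : ∀ {n} → Mono n → Poly n → ℕ
coeffOf a p = length (filter (λ m → ≡-dec _≟_ a m) p)

_*ₚ_ : ∀ {n} → Poly n → Poly n → Poly n
p *ₚ q = concatMap (λ m → map (zipWith _+_ m) q) p

oneₚ : ∀ {n} → Poly n
oneₚ {n} = [ replicate n 0 ]

-- the variable x_j (j : Fin n, 0-based index)
var : ∀ {n} → Fin n → Mono n
var j = tabulate (λ k → indicator k)
  where
  indicator : _ → ℕ
  indicator k with k ≟F j
  ... | Relation.Nullary.yes _ = 1
  ... | Relation.Nullary.no  _ = 0

-- the linear form x₁ + ⋯ + x_{k+1}  (k : Fin n, 0-based)
linForm : ∀ {n} → Fin n → Poly n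
linForm {n} k = map var (filter (λ j → toℕ j ≤? toℕ k) (allFin n))

-- p_n = x₁(x₁+x₂)⋯(x₁+⋯+xₙ), fully expanded
pₙ : (n : ℕ) → Poly n
pₙ n = foldr _*ₚ_ oneₚ (map linForm (allFin n))

c : (n : ℕ) → Mono n → ℕ
c n a = coeffOf a (pₙ n)

-- membership in 𝒜_n  (1-based: Σ_{i=k+1}^n a_i = sum of the list after dropping k entries)
InA : (n : ℕ) → Mono n → Set
InA n a = All (λ k → sum (drop k (toList a)) ≤ n ∸ k) (map suc (upTo (n ∸ 1)))
        × sum (toList a) ≡ n

inA? : (n : ℕ) (a : Mono n) → Dec (InA n a)
inA? n a = all? (λ k → sum (drop k (toList a)) ≤? n ∸ k) (map suc (upTo (n ∸ 1)))
           ×-dec (sum (toList a) ≟ n)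

TailZero : ∀ {n} → ℕ → Mono n → Set
TailZero i a = All (_≡ 0) (drop i (toList a))

tailZero? : ∀ {n} (i : ℕ) (a : Mono n) → Dec (TailZero i a)
tailZero? i a = all? (λ x → x ≟ 0) (drop i (toList a))

boxVecs : (m len : ℕ) → List (Vec ℕ len)
boxVecs m zero = Data.Vec.[] ∷ []
boxVecs m (suc len) = concatMap (λ x → map (x Data.Vec.∷_) (boxVecs m len)) (upTo (suc m))

-- 𝒜_n enumerated (every a ∈ 𝒜_n has entries ≤ n since Σ aᵢ = n)
𝒜 : (n : ℕ) → List (Mono n)
𝒜 n = filter (inA? n) (boxVecs n n)

restrictedSum : (n i : ℕ) → ℕ
restrictedSum n i = sum (map (c n) (filter (tailZero? i) (𝒜 n)))

-- Put x₁ = ⋯ = xᵢ = 1 and x_{i+1} = ⋯ = xₙ = 0.  A monomial of pₙ survives this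
-- substitution (with value 1) exactly when its tail a_{i+1},…,aₙ vanishes, so the sum
-- in question is pₙ evaluated at this point; there the factor x₁ + ⋯ + x_k becomes
-- min(k, i), and ∏_{k=1}^{n} min(k, i) = i!·i^{n−i}.  In the list representation of
-- pₙ the evaluation is the number of listed terms with vanishing tail, and since 𝒜ₙ is
-- enumerated without repetition and contains every exponent vector of pₙ, summing the
-- multiplicities over 𝒜ₙ counts each such term exactly once.
module Submission where

open import Defs
open import Data.Nat
  using (ℕ; zero; suc; _+_; _*_; _∸_; _^_; _≤_; _<_; _⊓_; _!; z≤n; s≤s; s≤s⁻¹; s<s; s<s⁻¹; z<s; _≤?_; _<?_)
open import Data.Nat.Properties
  using (_≟_; ≤-refl; ≤-trans; ≤-reflexive; +-mono-≤; m≤m+n; m≤n+m; m≤n⇒m≤1+n; ≮⇒≥; ≰⇒>; ≤-<-trans; m+n≡0⇒m≡0; m+n≡0⇒n≡0;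
         *-comm; *-assoc; *-identityʳ; +-identityʳ; +-suc; m≤n⇒m⊓n≡m; m≥n⇒m⊓n≡n; m⊓n≤m; ⊓-glb; m<n⊓o⇒m<n; m<n⊓o⇒m<o;
         m+[n∸m]≡n; +-commutativeSemigroup; module ≤-Reasoning)
open import Algebra.Properties.CommutativeSemigroup +-commutativeSemigroup using (interchange)
open import Data.Fin using (Fin; zero; suc; toℕ)
open import Data.Fin.Properties using (toℕ<n) renaming (_≟_ to _≟ᶠ_)
open import Data.Vec using (Vec; []; _∷_; toList; zipWith; replicate; tabulate)
open import Data.Vec.Properties using (tabulate-cong; ≡-dec; ∷-injective)
open import Data.List
  using (List; []; _∷_; [_]; _++_; drop; map; filter; length; foldr; concatMap; cartesianProductWith; applyUpTo; upTo; allFin)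
import Data.List as List
open import Data.List.Properties
  using (length-++; length-tabulate; filter-++; filter-all; filter-accept; filter-reject; filter-none; filter-≐;
         map-cong; map-cong-local; map-∘; map-tabulate; applyUpTo-∷ʳ)
open import Data.Nat.ListAction using (sum; product)
open import Data.Nat.ListAction.Properties using (product-++)
open import Data.List.Relation.Unary.All as All using (All; []; _∷_; universal)
open import Data.List.Relation.Unary.All.Properties using (map⁺; all-filter)
open import Data.List.Relation.Unary.Any using (here; there)
open import Data.List.Relation.Unary.AllPairs using ([]; _∷_)
open import Data.List.Relation.Unary.Unique.Propositional using (Unique)
import Data.List.Relation.Unary.Unique.Propositional.Properties as Unique
open import Data.List.Membership.Propositional using (_∈_)
open import Data.List.Membership.Propositional.Properties
  using (∈-filter⁺; ∈-filter⁻; ∈-map⁻; ∈-cartesianProductWith⁺; ∈-cartesianProductWith⁻; ∈-upTo⁺)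
open import Data.Product using (_×_; _,_; proj₁; proj₂; ∃₂)
open import Function using (_∘_; id)
open import Level using (Level)
open import Relation.Binary.Definitions using (DecidableEquality)
open import Relation.Binary.PropositionalEquality
  using (_≡_; _≢_; refl; sym; trans; cong; cong₂; subst; ≢-sym; module ≡-Reasoning)
open import Relation.Nullary using (Dec; yes; no; does; ¬_)
open import Relation.Unary using (Pred; Decidable)
open import Relation.Unary.Properties using (_∩?_)
open import Data.Bool using (true; false)

private
  variable
    ℓ ℓ′ : Level
    A B C : Set

length-filter-map : {P : Pred B ℓ} (P? : Decidable P) (f : A → B) (xs : List A) →
                    length (filter P? (map f xs)) ≡ length (filter (P? ∘ f) xs)
length-filter-map P? f [] = refl
length-filter-map P? f (x ∷ xs) with does (P? (f x))
... | true  = cong suc (length-filter-map P? f xs)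
... | false = length-filter-map P? f xs

filter-filter : {P : Pred A ℓ} {Q : Pred A ℓ′} (P? : Decidable P) (Q? : Decidable Q) (xs : List A) →
                filter P? (filter Q? xs) ≡ filter (P? ∩? Q?) xs
filter-filter P? Q? [] = refl
filter-filter P? Q? (x ∷ xs) with does (Q? x)
... | false with does (P? x)
...   | true  = filter-filter P? Q? xs
...   | false = filter-filter P? Q? xs
filter-filter P? Q? (x ∷ xs) | true with does (P? x)
...   | true  = cong (x ∷_) (filter-filter P? Q? xs)
...   | false = filter-filter P? Q? xs

All≡0⇒sum≡0 : {xs : List ℕ} → All (_≡ 0) xs → sum xs ≡ 0
All≡0⇒sum≡0 [] = refl
All≡0⇒sum≡0 (refl ∷ ps) = All≡0⇒sum≡0 ps

sum≡0⇒All≡0 : (xs : List ℕ) → sum xs ≡ 0 → All (_≡ 0) xs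
sum≡0⇒All≡0 [] _ = []
sum≡0⇒All≡0 (x ∷ xs) e = m+n≡0⇒m≡0 x e ∷ sum≡0⇒All≡0 xs (m+n≡0⇒n≡0 x e)

sum-map-+ : (f g : A → ℕ) (xs : List A) → sum (map (λ x → f x + g x) xs) ≡ sum (map f xs) + sum (map g xs)
sum-map-+ f g [] = refl
sum-map-+ f g (x ∷ xs) = trans (cong (f x + g x +_) (sum-map-+ f g xs)) (interchange (f x) (g x) _ _)

concatMap-map : (f : A → B → C) (xs : List A) (ys : List B) →
                concatMap (λ x → map (f x) ys) xs ≡ cartesianProductWith f xs ys
concatMap-map f [] ys = refl
concatMap-map f (x ∷ xs) ys = cong (map (f x) ys ++_) (concatMap-map f xs ys)

product-applyUpTo-suc : (f : ℕ → ℕ) (n : ℕ) → product (applyUpTo f (suc n)) ≡ product (applyUpTo f n) * f n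
product-applyUpTo-suc f n = begin
    product (applyUpTo f (suc n))             ≡⟨ cong product (applyUpTo-∷ʳ f n) ⟨
    product (applyUpTo f n ++ [ f n ])        ≡⟨ product-++ (applyUpTo f n) [ f n ] ⟩
    product (applyUpTo f n) * (f n * 1)       ≡⟨ cong (product (applyUpTo f n) *_) (*-identityʳ (f n)) ⟩
    product (applyUpTo f n) * f n             ∎
  where open ≡-Reasoning

module _ (_≟ₐ_ : DecidableEquality A) where

  multiplicity : A → List A → ℕ
  multiplicity x xs = length (filter (x ≟ₐ_) xs)

  multiplicity-∷ : (x : A) (xs : List A) (y : A) →
                   multiplicity y (x ∷ xs) ≡ multiplicity y [ x ] + multiplicity y xs
  multiplicity-∷ x xs y = trans (cong length (filter-++ (y ≟ₐ_) [ x ] xs)) (length-++ (filter (y ≟ₐ_) [ x ]))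

  sum-multiplicity-∉ : {x : A} {ys : List A} → All (_≢ x) ys → sum (map (λ y → multiplicity y [ x ]) ys) ≡ 0
  sum-multiplicity-∉ [] = refl
  sum-multiplicity-∉ {ys = y ∷ _} (y≢x ∷ ys≢x) =
    cong₂ _+_ (cong length (filter-reject (y ≟ₐ_) y≢x)) (sum-multiplicity-∉ ys≢x)

  sum-multiplicity-∈ : {x : A} {ys : List A} → Unique ys → x ∈ ys → sum (map (λ y → multiplicity y [ x ]) ys) ≡ 1
  sum-multiplicity-∈ {x} (x∉ys ∷ _) (here refl) =
    cong₂ _+_ (cong length (filter-accept (x ≟ₐ_) refl)) (sum-multiplicity-∉ (All.map ≢-sym x∉ys))
  sum-multiplicity-∈ {ys = y ∷ _} (y∉ys ∷ u) (there x∈ys) =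
    cong₂ _+_ (cong length (filter-reject (y ≟ₐ_) (All.lookup y∉ys x∈ys))) (sum-multiplicity-∈ u x∈ys)

  sum-multiplicity : {ys : List A} → Unique ys → (xs : List A) → (∀ {x} → x ∈ xs → x ∈ ys) →
                     sum (map (λ y → multiplicity y xs) ys) ≡ length xs
  sum-multiplicity {ys} _ [] _ = All≡0⇒sum≡0 (map⁺ (universal (λ _ → refl) ys))
  sum-multiplicity {ys} u (x ∷ xs) xs⊆ys = begin
      sum (map (λ y → multiplicity y (x ∷ xs)) ys)
    ≡⟨ cong sum (map-cong (multiplicity-∷ x xs) ys) ⟩
      sum (map (λ y → multiplicity y [ x ] + multiplicity y xs) ys)
    ≡⟨ sum-map-+ (λ y → multiplicity y [ x ]) (λ y → multiplicity y xs) ys ⟩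
      sum (map (λ y → multiplicity y [ x ]) ys) + sum (map (λ y → multiplicity y xs) ys)
    ≡⟨ cong₂ _+_ (sum-multiplicity-∈ u (xs⊆ys (here refl))) (sum-multiplicity u xs (xs⊆ys ∘ there)) ⟩
      suc (length xs)
    ∎
    where open ≡-Reasoning

  multiplicity-filter : {P : Pred A ℓ} (P? : Decidable P) {x : A} → P x → (xs : List A) →
                        multiplicity x (filter P? xs) ≡ multiplicity x xs
  multiplicity-filter {P = P} P? {x} Px xs =
    trans (cong length (filter-filter (x ≟ₐ_) P? xs))
          (cong length (filter-≐ ((x ≟ₐ_) ∩? P?) (x ≟ₐ_) (proj₁ , λ x≡y → x≡y , subst P x≡y Px) xs))

  sum-multiplicity-filter : {P : Pred A ℓ} (P? : Decidable P) (xs : List A) {ys : List A} →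
                            Unique ys → All P ys → (∀ {x} → x ∈ filter P? xs → x ∈ ys) →
                            sum (map (λ y → multiplicity y xs) ys) ≡ length (filter P? xs)
  sum-multiplicity-filter P? xs u Pys ⊆ys =
    trans (cong sum (map-cong-local (All.map (λ Py → sym (multiplicity-filter P? Py xs)) Pys)))
          (sum-multiplicity u (filter P? xs) ⊆ys)

allFin-suc : (n : ℕ) → allFin (suc n) ≡ zero ∷ map suc (allFin n)
allFin-suc n = cong (zero ∷_) (sym (map-tabulate id suc))

length-filter-allFin-suc : {n : ℕ} {P : Pred (Fin (suc n)) ℓ} (P? : Decidable P) →
  length (filter P? (allFin (suc n))) ≡ length (filter P? [ zero ]) + length (filter (P? ∘ suc) (allFin n))
length-filter-allFin-suc {n = n} P? = begin
    length (filter P? (allFin (suc n)))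
  ≡⟨ cong (length ∘ filter P?) (allFin-suc n) ⟩
    length (filter P? ([ zero ] ++ map suc (allFin n)))
  ≡⟨ cong length (filter-++ P? [ zero ] (map suc (allFin n))) ⟩
    length (filter P? [ zero ] ++ filter P? (map suc (allFin n)))
  ≡⟨ length-++ (filter P? [ zero ]) ⟩
    length (filter P? [ zero ]) + length (filter P? (map suc (allFin n)))
  ≡⟨ cong (length (filter P? [ zero ]) +_) (length-filter-map P? suc (allFin n)) ⟩
    length (filter P? [ zero ]) + length (filter (P? ∘ suc) (allFin n))
  ∎
  where open ≡-Reasoning

length-filter-toℕ<-allFin : {m n : ℕ} → m ≤ n → length (filter (λ (j : Fin n) → toℕ j <? m) (allFin n)) ≡ m
length-filter-toℕ<-allFin {zero} {n} _ = cong length (filter-none (λ j → toℕ j <? 0) (universal (λ _ ()) (allFin n)))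
length-filter-toℕ<-allFin {suc m} {suc n} (s≤s m≤n) = begin
    length (filter P? (allFin (suc n)))
  ≡⟨ length-filter-allFin-suc P? ⟩
    length (filter P? [ zero ]) + length (filter (P? ∘ suc) (allFin n))
  ≡⟨ cong₂ _+_ (cong length (filter-accept P? {xs = []} z<s)) (cong length (filter-≐ (P? ∘ suc) Q? (s<s⁻¹ , s<s) (allFin n))) ⟩
    suc (length (filter Q? (allFin n)))
  ≡⟨ cong suc (length-filter-toℕ<-allFin m≤n) ⟩
    suc m
  ∎
  where
  open ≡-Reasoning
  P? : (j : Fin (suc n)) → Dec (toℕ j < suc m)
  P? j = toℕ j <? suc m
  Q? : (j : Fin n) → Dec (toℕ j < m)
  Q? j = toℕ j <? m

length-filter-≤toℕ-allFin : (k n : ℕ) → length (filter (λ (j : Fin n) → k ≤? toℕ j) (allFin n)) ≡ n ∸ k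
length-filter-≤toℕ-allFin zero n =
  trans (cong length (filter-all (λ (j : Fin n) → 0 ≤? toℕ j) (universal (λ _ → z≤n) (allFin n)))) (length-tabulate id)
length-filter-≤toℕ-allFin (suc k) zero = refl
length-filter-≤toℕ-allFin (suc k) (suc n) = begin
    length (filter P? (allFin (suc n)))
  ≡⟨ length-filter-allFin-suc P? ⟩
    length (filter P? [ zero ]) + length (filter (P? ∘ suc) (allFin n))
  ≡⟨ cong₂ _+_ (cong length (filter-reject P? {zero} {[]} (λ ()))) (cong length (filter-≐ (P? ∘ suc) Q? (s≤s⁻¹ , s≤s) (allFin n))) ⟩
    length (filter Q? (allFin n))
  ≡⟨ length-filter-≤toℕ-allFin k n ⟩
    n ∸ k
  ∎
  where
  open ≡-Reasoning
  P? : (j : Fin (suc n)) → Dec (suc k ≤ toℕ j)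
  P? j = suc k ≤? toℕ j
  Q? : (j : Fin n) → Dec (k ≤ toℕ j)
  Q? j = k ≤? toℕ j

tabulate-toℕ : (f : ℕ → A) (n : ℕ) → List.tabulate {n = n} (f ∘ toℕ) ≡ applyUpTo f n
tabulate-toℕ f zero = refl
tabulate-toℕ f (suc n) = cong (f 0 ∷_) (tabulate-toℕ (f ∘ suc) n)

tailSum : {n : ℕ} → ℕ → Mono n → ℕ
tailSum k a = sum (drop k (toList a))

tailSum-zipWith-+ : {n : ℕ} (k : ℕ) (a b : Mono n) → tailSum k (zipWith _+_ a b) ≡ tailSum k a + tailSum k b
tailSum-zipWith-+ zero    []      []      = refl
tailSum-zipWith-+ (suc k) []      []      = refl
tailSum-zipWith-+ zero    (x ∷ a) (y ∷ b) =
  trans (cong (x + y +_) (tailSum-zipWith-+ zero a b)) (interchange x y (tailSum zero a) (tailSum zero b))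
tailSum-zipWith-+ (suc k) (x ∷ a) (y ∷ b) = tailSum-zipWith-+ k a b

tailSum-replicate-0 : (k n : ℕ) → tailSum k (replicate n 0) ≡ 0
tailSum-replicate-0 zero    zero    = refl
tailSum-replicate-0 (suc k) zero    = refl
tailSum-replicate-0 zero    (suc n) = tailSum-replicate-0 zero n
tailSum-replicate-0 (suc k) (suc n) = tailSum-replicate-0 k n

tabulate-const : {n : ℕ} (x : A) → tabulate {n = n} (λ _ → x) ≡ replicate n x
tabulate-const {n = zero}  x = refl
tabulate-const {n = suc n} x = cong (x ∷_) (tabulate-const x)

var-zero : {n : ℕ} → var {suc n} zero ≡ 1 ∷ replicate n 0
var-zero = cong (1 ∷_) (tabulate-const 0)

-- The entries of var come from a local function of Defs that cannot be named here, so
-- the type of var-suc-entry is left for unification with its use in var-suc.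
mutual
  var-suc : {n : ℕ} (j : Fin n) → var (suc j) ≡ 0 ∷ var j
  var-suc j = cong (0 ∷_) (tabulate-cong (var-suc-entry j))

  var-suc-entry : {n : ℕ} (j k : Fin n) → _ ≡ _
  var-suc-entry j k with k ≟ᶠ j
  ... | yes _ = refl
  ... | no  _ = refl

tailSum-var-< : {n k : ℕ} {j : Fin n} → toℕ j < k → tailSum k (var j) ≡ 0
tailSum-var-< {suc n} {suc k} {zero}  _         = trans (cong (tailSum (suc k)) (var-zero {n})) (tailSum-replicate-0 k n)
tailSum-var-< {suc n} {suc k} {suc j} (s<s j<k) = trans (cong (tailSum (suc k)) (var-suc j)) (tailSum-var-< j<k)

tailSum-var-≥ : {n k : ℕ} {j : Fin n} → k ≤ toℕ j → tailSum k (var j) ≡ 1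
tailSum-var-≥ {suc n} {zero}  {zero}  _           = trans (cong (tailSum 0) (var-zero {n})) (cong suc (tailSum-replicate-0 0 n))
tailSum-var-≥ {suc n} {zero}  {suc j} _           = trans (cong (tailSum 0) (var-suc j)) (tailSum-var-≥ {j = j} z≤n)
tailSum-var-≥ {suc n} {suc k} {suc j} (s≤s k≤j)   = trans (cong (tailSum (suc k)) (var-suc j)) (tailSum-var-≥ k≤j)

tailSum-var-≤1 : {n : ℕ} (k : ℕ) (j : Fin n) → tailSum k (var j) ≤ 1
tailSum-var-≤1 k j with toℕ j <? k
... | yes j<k = ≤-trans (≤-reflexive (tailSum-var-< j<k)) z≤n
... | no  j≮k = ≤-reflexive (tailSum-var-≥ (≮⇒≥ j≮k))

TailZero-zipWith⁻ : {n : ℕ} (k : ℕ) (a b : Mono n) → TailZero k (zipWith _+_ a b) → TailZero k a × TailZero k b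
TailZero-zipWith⁻ k a b t =
  sum≡0⇒All≡0 _ (m+n≡0⇒m≡0 (tailSum k a) a+b≡0) , sum≡0⇒All≡0 _ (m+n≡0⇒n≡0 (tailSum k a) a+b≡0)
  where
  a+b≡0 : tailSum k a + tailSum k b ≡ 0
  a+b≡0 = trans (sym (tailSum-zipWith-+ k a b)) (All≡0⇒sum≡0 t)

TailZero-zipWith⁺ : {n : ℕ} (k : ℕ) (a b : Mono n) → TailZero k a → TailZero k b → TailZero k (zipWith _+_ a b)
TailZero-zipWith⁺ k a b ta tb =
  sum≡0⇒All≡0 _ (trans (tailSum-zipWith-+ k a b) (cong₂ _+_ (All≡0⇒sum≡0 ta) (All≡0⇒sum≡0 tb)))

TailZero-replicate-0 : (k n : ℕ) → TailZero k (replicate n 0)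
TailZero-replicate-0 k n = sum≡0⇒All≡0 _ (tailSum-replicate-0 k n)

TailZero-var⁺ : {n k : ℕ} {j : Fin n} → toℕ j < k → TailZero k (var j)
TailZero-var⁺ j<k = sum≡0⇒All≡0 _ (tailSum-var-< j<k)

TailZero-var⁻ : {n k : ℕ} {j : Fin n} → TailZero k (var j) → toℕ j < k
TailZero-var⁻ {k = k} {j} t with toℕ j <? k
... | yes j<k = j<k
... | no  j≮k with () ← trans (sym (tailSum-var-≥ (≮⇒≥ j≮k))) (All≡0⇒sum≡0 t)

-- Evaluation at x₁ = ⋯ = xᵢ = 1, x_{i+1} = ⋯ = xₙ = 0

countTailZero : {n : ℕ} → ℕ → Poly n → ℕ
countTailZero i p = length (filter (tailZero? i) p)

countTailZero-++ : {n : ℕ} (i : ℕ) (p q : Poly n) → countTailZero i (p ++ q) ≡ countTailZero i p + countTailZero i q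
countTailZero-++ i p q = trans (cong length (filter-++ (tailZero? i) p q)) (length-++ (filter (tailZero? i) p))

countTailZero-shift⁺ : {n : ℕ} (i : ℕ) {a : Mono n} → TailZero i a → (q : Poly n) →
                       countTailZero i (map (zipWith _+_ a) q) ≡ countTailZero i q
countTailZero-shift⁺ i {a} ta q =
  trans (length-filter-map (tailZero? i) (zipWith _+_ a) q)
        (cong length (filter-≐ (tailZero? i ∘ zipWith _+_ a) (tailZero? i)
                               ((λ {b} → proj₂ ∘ TailZero-zipWith⁻ i a b) , λ {b} → TailZero-zipWith⁺ i a b ta) q))

countTailZero-shift⁻ : {n : ℕ} (i : ℕ) {a : Mono n} → ¬ TailZero i a → (q : Poly n) →
                       countTailZero i (map (zipWith _+_ a) q) ≡ 0
countTailZero-shift⁻ i {a} ¬ta q =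
  cong length (filter-none (tailZero? i) (map⁺ (universal (λ b → ¬ta ∘ proj₁ ∘ TailZero-zipWith⁻ i a b) q)))

countTailZero-*ₚ : {n : ℕ} (i : ℕ) (p q : Poly n) → countTailZero i (p *ₚ q) ≡ countTailZero i p * countTailZero i q
countTailZero-*ₚ i [] q = refl
countTailZero-*ₚ i (a ∷ p) q with tailZero? i a
... | yes ta = trans (countTailZero-++ i (map (zipWith _+_ a) q) (p *ₚ q))
                     (cong₂ _+_ (countTailZero-shift⁺ i ta q) (countTailZero-*ₚ i p q))
... | no ¬ta = trans (countTailZero-++ i (map (zipWith _+_ a) q) (p *ₚ q))
                     (cong₂ _+_ (countTailZero-shift⁻ i ¬ta q) (countTailZero-*ₚ i p q))

countTailZero-oneₚ : {n : ℕ} (i : ℕ) → countTailZero i (oneₚ {n}) ≡ 1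
countTailZero-oneₚ {n} i = cong length (filter-accept (tailZero? i) {xs = []} (TailZero-replicate-0 i n))

countTailZero-foldr : {n : ℕ} (i : ℕ) (ps : List (Poly n)) →
                      countTailZero i (foldr _*ₚ_ oneₚ ps) ≡ product (map (countTailZero i) ps)
countTailZero-foldr i [] = countTailZero-oneₚ i
countTailZero-foldr i (p ∷ ps) =
  trans (countTailZero-*ₚ i p (foldr _*ₚ_ oneₚ ps)) (cong (countTailZero i p *_) (countTailZero-foldr i ps))

countTailZero-linForm : {n : ℕ} (i : ℕ) (l : Fin n) → countTailZero i (linForm l) ≡ suc (toℕ l) ⊓ i
countTailZero-linForm {n} i l = begin
    length (filter (tailZero? i) (map var (filter ≤l? (allFin n))))
  ≡⟨ length-filter-map (tailZero? i) var (filter ≤l? (allFin n)) ⟩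
    length (filter (tailZero? i ∘ var) (filter ≤l? (allFin n)))
  ≡⟨ cong length (filter-filter (tailZero? i ∘ var) ≤l? (allFin n)) ⟩
    length (filter ((tailZero? i ∘ var) ∩? ≤l?) (allFin n))
  ≡⟨ cong length (filter-≐ ((tailZero? i ∘ var) ∩? ≤l?) <l⊓i? (both⇒<l⊓i , <l⊓i⇒both) (allFin n)) ⟩
    length (filter <l⊓i? (allFin n))
  ≡⟨ length-filter-toℕ<-allFin (≤-trans (m⊓n≤m (suc (toℕ l)) i) (toℕ<n l)) ⟩
    suc (toℕ l) ⊓ i
  ∎
  where
  open ≡-Reasoning
  ≤l? : (j : Fin n) → Dec (toℕ j ≤ toℕ l)
  ≤l? j = toℕ j ≤? toℕ l
  <l⊓i? : (j : Fin n) → Dec (toℕ j < suc (toℕ l) ⊓ i)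
  <l⊓i? j = toℕ j <? suc (toℕ l) ⊓ i
  both⇒<l⊓i : {j : Fin n} → TailZero i (var j) × toℕ j ≤ toℕ l → toℕ j < suc (toℕ l) ⊓ i
  both⇒<l⊓i (t , j≤l) = ⊓-glb (s≤s j≤l) (TailZero-var⁻ t)
  <l⊓i⇒both : {j : Fin n} → toℕ j < suc (toℕ l) ⊓ i → TailZero i (var j) × toℕ j ≤ toℕ l
  <l⊓i⇒both j< = TailZero-var⁺ (m<n⊓o⇒m<o (suc (toℕ l)) i j<) , s≤s⁻¹ (m<n⊓o⇒m<n (suc (toℕ l)) i j<)

minProduct : ℕ → ℕ → ℕ
minProduct i n = product (applyUpTo (λ k → suc k ⊓ i) n)

minProduct-suc : (i n : ℕ) → minProduct i (suc n) ≡ minProduct i n * (suc n ⊓ i)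
minProduct-suc i = product-applyUpTo-suc (λ k → suc k ⊓ i)

minProduct-≤ : {i n : ℕ} → n ≤ i → minProduct i n ≡ n !
minProduct-≤ {i} {zero} _ = refl
minProduct-≤ {i} {suc n} n<i = begin
    minProduct i (suc n)          ≡⟨ minProduct-suc i n ⟩
    minProduct i n * (suc n ⊓ i)  ≡⟨ cong₂ _*_ (minProduct-≤ (≤-trans (m≤n+m n 1) n<i)) (m≤n⇒m⊓n≡m n<i) ⟩
    n ! * suc n                   ≡⟨ *-comm (n !) (suc n) ⟩
    suc n !                       ∎
  where open ≡-Reasoning

minProduct-+ : (i k : ℕ) → minProduct i (i + k) ≡ i ! * i ^ k
minProduct-+ i zero = begin
    minProduct i (i + 0)  ≡⟨ cong (minProduct i) (+-identityʳ i) ⟩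
    minProduct i i        ≡⟨ minProduct-≤ {i} ≤-refl ⟩
    i !                   ≡⟨ *-identityʳ (i !) ⟨
    i ! * 1               ∎
  where open ≡-Reasoning
minProduct-+ i (suc k) = begin
    minProduct i (i + suc k)                    ≡⟨ cong (minProduct i) (+-suc i k) ⟩
    minProduct i (suc (i + k))                  ≡⟨ minProduct-suc i (i + k) ⟩
    minProduct i (i + k) * (suc (i + k) ⊓ i)    ≡⟨ cong₂ _*_ (minProduct-+ i k) (m≥n⇒m⊓n≡n (m≤n⇒m≤1+n (m≤m+n i k))) ⟩
    i ! * i ^ k * i                             ≡⟨ *-assoc (i !) (i ^ k) i ⟩
    i ! * (i ^ k * i)                           ≡⟨ cong (i ! *_) (*-comm (i ^ k) i) ⟩
    i ! * i ^ suc k                             ∎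
  where open ≡-Reasoning

countTailZero-pₙ : {n i : ℕ} → i ≤ n → countTailZero i (pₙ n) ≡ i ! * i ^ (n ∸ i)
countTailZero-pₙ {n} {i} i≤n = begin
    countTailZero i (pₙ n)
  ≡⟨ countTailZero-foldr i (map linForm (allFin n)) ⟩
    product (map (countTailZero i) (map linForm (allFin n)))
  ≡⟨ cong product (map-∘ (allFin n)) ⟨
    product (map (countTailZero i ∘ linForm) (allFin n))
  ≡⟨ cong product (map-cong (countTailZero-linForm i) (allFin n)) ⟩
    product (map ((λ x → suc x ⊓ i) ∘ toℕ) (allFin n))
  ≡⟨ cong product (trans (map-tabulate id _) (tabulate-toℕ (λ x → suc x ⊓ i) n)) ⟩
    minProduct i n
  ≡⟨ cong (minProduct i) (m+[n∸m]≡n i≤n) ⟨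
    minProduct i (i + (n ∸ i))
  ≡⟨ minProduct-+ i (n ∸ i) ⟩
    i ! * i ^ (n ∸ i)
  ∎
  where open ≡-Reasoning

-- Every exponent vector of pₙ lies in 𝒜ₙ

∈-*ₚ⁻ : {n : ℕ} (p q : Poly n) {m : Mono n} → m ∈ p *ₚ q → ∃₂ λ a b → a ∈ p × b ∈ q × m ≡ zipWith _+_ a b
∈-*ₚ⁻ p q m∈ = ∈-cartesianProductWith⁻ (zipWith _+_) p q (subst (_ ∈_) (concatMap-map (zipWith _+_) p q) m∈)

∈-linForm-*ₚ⁻ : {n : ℕ} (l : Fin n) (q : Poly n) {m : Mono n} → m ∈ linForm l *ₚ q →
                ∃₂ λ j b → toℕ j ≤ toℕ l × b ∈ q × m ≡ zipWith _+_ (var j) b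
∈-linForm-*ₚ⁻ {n} l q m∈ with ∈-*ₚ⁻ (linForm l) q m∈
... | a , b , a∈ , b∈ , refl with ∈-map⁻ var a∈
...   | j , j∈ , refl = j , b , proj₂ (∈-filter⁻ (λ (j : Fin n) → toℕ j ≤? toℕ l) {xs = allFin n} j∈) , b∈ , refl

tailSum-0-∈-linForms : {n : ℕ} (ls : List (Fin n)) {m : Mono n} → m ∈ foldr _*ₚ_ oneₚ (map linForm ls) →
                       tailSum 0 m ≡ length ls
tailSum-0-∈-linForms {n} [] (here refl) = tailSum-replicate-0 0 n
tailSum-0-∈-linForms (l ∷ ls) m∈ with ∈-linForm-*ₚ⁻ l _ m∈
... | j , b , _ , b∈ , refl =
  trans (tailSum-zipWith-+ 0 (var j) b) (cong₂ _+_ (tailSum-var-≥ {j = j} z≤n) (tailSum-0-∈-linForms ls b∈))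

tailSum-∈-linForms : {n : ℕ} (k : ℕ) (ls : List (Fin n)) {m : Mono n} → m ∈ foldr _*ₚ_ oneₚ (map linForm ls) →
                     tailSum k m ≤ length (filter (λ l → k ≤? toℕ l) ls)
tailSum-∈-linForms {n} k [] (here refl) = ≤-reflexive (tailSum-replicate-0 k n)
tailSum-∈-linForms k (l ∷ ls) m∈ with ∈-linForm-*ₚ⁻ l _ m∈
... | j , b , j≤l , b∈ , refl = begin
    tailSum k (zipWith _+_ (var j) b)       ≡⟨ tailSum-zipWith-+ k (var j) b ⟩
    tailSum k (var j) + tailSum k b         ≤⟨ +-mono-≤ var-bound (tailSum-∈-linForms k ls b∈) ⟩
    [k≤l] + length (filter k≤? ls)          ≡⟨ length-++ (filter k≤? [ l ]) ⟨
    length (filter k≤? [ l ] ++ filter k≤? ls) ≡⟨ cong length (filter-++ k≤? [ l ] ls) ⟨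
    length (filter k≤? (l ∷ ls))            ∎
  where
  open ≤-Reasoning
  k≤? : (l : Fin _) → Dec (k ≤ toℕ l)
  k≤? l = k ≤? toℕ l
  [k≤l] : ℕ
  [k≤l] = length (filter k≤? [ l ])
  var-bound : tailSum k (var j) ≤ [k≤l]
  var-bound with k ≤? toℕ l
  ... | yes k≤l = ≤-trans (tailSum-var-≤1 k j) (≤-reflexive (sym (cong length (filter-accept k≤? {xs = []} k≤l))))
  ... | no  k≰l = ≤-trans (≤-reflexive (tailSum-var-< (≤-<-trans j≤l (≰⇒> k≰l)))) z≤n

boxVecs-cartesian : (M len : ℕ) → boxVecs M (suc len) ≡ cartesianProductWith _∷_ (upTo (suc M)) (boxVecs M len)
boxVecs-cartesian M len = concatMap-map _∷_ (upTo (suc M)) (boxVecs M len)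

boxVecs-unique : (M len : ℕ) → Unique (boxVecs M len)
boxVecs-unique M zero = [] ∷ []
boxVecs-unique M (suc len) = subst Unique (sym (boxVecs-cartesian M len))
  (Unique.cartesianProductWith⁺ _∷_ ∷-injective (Unique.upTo⁺ (suc M)) (boxVecs-unique M len))

∈-boxVecs : (M : ℕ) {len : ℕ} (v : Vec ℕ len) → tailSum 0 v ≤ M → v ∈ boxVecs M len
∈-boxVecs M [] _ = here refl
∈-boxVecs M {suc len} (x ∷ v) x+v≤M = subst (x ∷ v ∈_) (sym (boxVecs-cartesian M len))
  (∈-cartesianProductWith⁺ _∷_ (∈-upTo⁺ (s≤s (≤-trans (m≤m+n x (tailSum 0 v)) x+v≤M)))
                               (∈-boxVecs M v (≤-trans (m≤n+m (tailSum 0 v) x) x+v≤M)))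

∈-𝒜 : (n : ℕ) {m : Mono n} → m ∈ pₙ n → m ∈ 𝒜 n
∈-𝒜 n {m} m∈pₙ = ∈-filter⁺ (inA? n) (∈-boxVecs n m (≤-reflexive degree)) (All.tabulate (λ {k} _ → tail-bound k) , degree)
  where
  degree : tailSum 0 m ≡ n
  degree = trans (tailSum-0-∈-linForms (allFin n) m∈pₙ) (length-tabulate id)
  tail-bound : (k : ℕ) → tailSum k m ≤ n ∸ k
  tail-bound k = ≤-trans (tailSum-∈-linForms k (allFin n) m∈pₙ) (≤-reflexive (length-filter-≤toℕ-allFin k n))

lemma8 : (n i : ℕ) → 1 ≤ i → i ≤ n →
         restrictedSum n i ≡ (i !) * i ^ (n ∸ i)
lemma8 n i _ i≤n = begin
    restrictedSum n i
  ≡⟨ sum-multiplicity-filter (≡-dec _≟_) (tailZero? i) (pₙ n) tailZero𝒜-unique (all-filter (tailZero? i) (𝒜 n)) tailZero-pₙ⊆𝒜 ⟩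
    countTailZero i (pₙ n)
  ≡⟨ countTailZero-pₙ i≤n ⟩
    i ! * i ^ (n ∸ i)
  ∎
  where
  open ≡-Reasoning
  tailZero𝒜-unique : Unique (filter (tailZero? i) (𝒜 n))
  tailZero𝒜-unique = Unique.filter⁺ (tailZero? i) (Unique.filter⁺ (inA? n) (boxVecs-unique n n))
  tailZero-pₙ⊆𝒜 : {m : Mono n} → m ∈ filter (tailZero? i) (pₙ n) → m ∈ filter (tailZero? i) (𝒜 n)
  tailZero-pₙ⊆𝒜 m∈ with m∈pₙ , t ← ∈-filter⁻ (tailZero? i) {xs = pₙ n} m∈ = ∈-filter⁺ (tailZero? i) (∈-𝒜 n m∈pₙ) t
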